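{- Let $\Gamma$ be a generating set of $S_n$. Then \[ S_\Gamma(n) \leq S(n) \cdot \mathrm{diam}(\mathrm{Cay}(S_n, \Gamma)) \quad\text{and}\quad A_\Gamma(n) \leq A(n) \cdot \mathrm{diam}(\mathrm{Cay}(S_n, \Gamma)). \]
   Context: Permutation Mastermind: secret $\sigma^\star\in S_n$, black-peg score $b(\pi,\sigma^\star) := |\{i\in[n]:\pi(i)=\sigma^\star(i)\}|$. Adaptive strategy: each guess is a function of the previous guesses and scores; the game is won when a guess equals $\sigma^\star$. $A(n)$ is the minimum worst-case number of guesses of an adaptive strategy. Static strategy: a fixed list $(\pi_1,\dots,\pi_T)$ announced in advance; after receiving all scores the codebreaker makes one final guess, which must equal $\sigma^\star$; $S(n)$ is the minimum list length $T$ of a correct static strategy. $\mathrm{Cay}(S_n,\Gamma)$ is the Cayley graph with vertex set $S_n$ and an edge from $\pi$ to $\pi\gamma$ for each $\gamma \in \Gamma$; its diameter is the maximum over $\pi,\sigma$ of the least $r$ such that $\pi^{ -1}\sigma$ is a product of $r$ elements of $\Gamma$. In the $\Gamma$-Permutation-Mastermind game, the first guess is arbitrary and each subsequent guess $\pi_{t}$ must satisfy $\pi_{t-1}^{ -1}\pi_t \in \Gamma$ (in the static case this applies to the list; the final guess is unrestricted). $A_\Gamma(n)$ and $S_\Gamma(n)$ are the analogues of $A(n)$ and $S(n)$ for strategies obeying this restriction. -}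

module Defs where

open import Data.Nat using (ℕ; zero; suc; _≤_; _<_)
open import Data.Fin using (Fin; _≟_)
open import Data.Fin.Permutation using (Permutation′; _⟨$⟩ʳ_; _≈_; _∘ₚ_)
open import Data.List using (List; []; _∷_; _++_; [_]; length; filter; map; allFin)
open import Data.List.Membership.Propositional using (_∈_)
open import Data.Product using (Σ; ∃; _×_)
open import Relation.Nullary using (¬_)

Perm : ℕ → Set
Perm n = Permutation′ n

-- Group product (π · γ)(i) = π (γ i).  (Note: stdlib's _∘ₚ_ is diagrammatic.)
_·_ : ∀ {n} → Perm n → Perm n → Perm n
π · γ = γ ∘ₚ π

score : ∀ {n} → Perm n → Perm n → ℕ
score {n} π σ = length (filter (λ i → (π ⟨$⟩ʳ i) ≟ (σ ⟨$⟩ʳ i)) (allFin n))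

_∈Γ_ : ∀ {n} → Perm n → List (Perm n) → Set
ρ ∈Γ Γ = ∃ λ γ → γ ∈ Γ × γ ≈ ρ

-- Reach Γ r π σ : σ = π γ₁ ⋯ γ_r for some γ₁,…,γ_r ∈ Γ,
-- i.e. π⁻¹σ is a product of r elements of Γ (a walk of length r in Cay(S_n,Γ)).
Reach : ∀ {n} → List (Perm n) → ℕ → Perm n → Perm n → Set
Reach Γ zero    π σ = π ≈ σ
Reach Γ (suc r) π σ = ∃ λ γ → γ ∈Γ Γ × Reach Γ r (π · γ) σ

-- Γ generates S_n (as a monoid; equivalent to as a group since S_n is finite):
-- every permutation is a product of finitely many elements of Γ.
Generates : ∀ {n} → List (Perm n) → Set
Generates {n} Γ = (σ : Perm n) → ∃ λ r → Reach Γ r (Data.Fin.Permutation.id) σ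

DiamLE : ∀ {n} → List (Perm n) → ℕ → Set
DiamLE {n} Γ D = (π σ : Perm n) → ∃ λ r → r ≤ D × Reach Γ r π σ

Step : ∀ {n} → List (Perm n) → Perm n → Perm n → Set
Step Γ π π' = ∃ λ γ → γ ∈Γ Γ × (π · γ) ≈ π'

-- Adaptive strategies: the next guess is a function of the scores so far
-- (the previous guesses are themselves determined by those scores).

Strategy : ℕ → Set
Strategy n = List ℕ → Perm n

-- history of scores before guess number k (guesses numbered 0,1,2,…)
history : ∀ {n} → Strategy n → Perm n → ℕ → List ℕ
history s σ zero    = []
history s σ (suc k) = history s σ k ++ [ score (s (history s σ k)) σ ]

guess : ∀ {n} → Strategy n → Perm n → ℕ → Perm n
guess s σ k = s (history s σ k)

WinsWithin : ∀ {n} → Strategy n → ℕ → Set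
WinsWithin {n} s T = (σ : Perm n) → ∃ λ k → k < T × guess s σ k ≈ σ

-- every guess actually made (i.e. while the game is not yet won) is a Γ-move
-- from the previous one
ObeysΓ : ∀ {n} → List (Perm n) → Strategy n → Set
ObeysΓ {n} Γ s = (σ : Perm n) (k : ℕ) →
  ((j : ℕ) → j ≤ k → ¬ (guess s σ j ≈ σ)) →
  Step Γ (guess s σ k) (guess s σ (suc k))

AdaptiveLE : ℕ → ℕ → Set
AdaptiveLE n T = ∃ λ (s : Strategy n) → WinsWithin s T

AdaptiveΓLE : ∀ {n} → List (Perm n) → ℕ → Set
AdaptiveΓLE {n} Γ T = ∃ λ (s : Strategy n) → ObeysΓ Γ s × WinsWithin s T

StaticCorrect : ∀ {n} → List (Perm n) → Set
StaticCorrect {n} L =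
  ∃ λ (final : List ℕ → Perm n) → (σ : Perm n) → final (map (λ π → score π σ) L) ≈ σ

ChainΓ : ∀ {n} → List (Perm n) → List (Perm n) → Set
ChainΓ Γ []           = Data.Unit.⊤ where import Data.Unit
ChainΓ Γ (π ∷ [])     = Data.Unit.⊤ where import Data.Unit
ChainΓ Γ (π ∷ π' ∷ L) = Step Γ π π' × ChainΓ Γ (π' ∷ L)

StaticLE : ℕ → ℕ → Set
StaticLE n T = ∃ λ (L : List (Perm n)) → length L ≤ T × StaticCorrect L

StaticΓLE : ∀ {n} → List (Perm n) → ℕ → Set
StaticΓLE {n} Γ T = ∃ λ (L : List (Perm n)) → length L ≤ T × ChainΓ Γ L × StaticCorrect L

{-# OPTIONS --safe #-}
-- Replace every guess of an unrestricted strategy by a walk of at most D Γ-moves in the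
-- Cayley graph from the previous guess to it. The walk ends at the original guess, so the
-- score there is the original score: the codebreaker reads the original scores off the new
-- ones and runs the original strategy alongside. A static list thus grows by a factor of at
-- most D, and an adaptive strategy that wins at its k-th guess is simulated by one that wins
-- after at most k·D Γ-moves.
module Submission where

open import Defs
open import Data.Nat using (ℕ; zero; suc; _+_; _*_; _≤_; _<_; z≤n; s≤s)
open import Data.Nat.Properties
  using (≤-trans; <-≤-trans; <⇒≤; ≮⇒≥; _<?_; suc-injective; +-suc; +-identityʳ; +-comm; m<n+m
        ; +-mono-≤; +-monoˡ-≤; *-monoˡ-≤)
open import Data.Fin using (_≟_)
open import Data.Fin.Patterns using (0F; 1F)
open import Data.Fin.Permutation using (_≈_; _⟨$⟩ʳ_; id; transpose)
open import Data.List
  using (List; []; _∷_; _++_; [_]; _∷ʳ_; length; map; allFin; filter; initLast; _∷ʳ′_)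
open import Data.List.Properties
  using (∷-injectiveˡ; ∷-injectiveʳ; ∷ʳ-++; ++-conicalʳ; length-++; map-++; filter-≐)
open import Data.Product using (_×_; _,_; ∃; ∃₂; proj₂)
open import Data.Unit using (tt)
open import Relation.Binary.PropositionalEquality
  using (_≡_; refl; sym; trans; cong; cong₂; subst; subst₂; module ≡-Reasoning)
open import Relation.Nullary using (yes; no; contradiction)

≈-trans : ∀ {n} {π ρ τ : Perm n} → π ≈ ρ → ρ ≈ τ → π ≈ τ
≈-trans π≈ρ ρ≈τ i = trans (π≈ρ i) (ρ≈τ i)

score-congˡ : ∀ {n} {π π′ : Perm n} (σ : Perm n) → π ≈ π′ → score π σ ≡ score π′ σ
score-congˡ {n} {π} {π′} σ π≈π′ =
  cong length (filter-≐ (λ i → π ⟨$⟩ʳ i ≟ σ ⟨$⟩ʳ i) (λ i → π′ ⟨$⟩ʳ i ≟ σ ⟨$⟩ʳ i)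
                        ((λ {i} → trans (sym (π≈π′ i))) , (λ {i} → trans (π≈π′ i)))
                        (allFin n))

scores : ∀ {n} → Perm n → List (Perm n) → List ℕ
scores σ = map (λ π → score π σ)

length-∷ʳ : ∀ {A : Set} (xs : List A) (x : A) → length (xs ∷ʳ x) ≡ suc (length xs)
length-∷ʳ xs x = trans (length-++ xs) (+-comm (length xs) 1)

consecutive : ∀ {A : Set} k (pre : List A) {p post} → k < length pre →
              ∃ λ B → ∃₂ λ a b → ∃ λ C → pre ++ p ∷ post ≡ B ++ a ∷ b ∷ C × length B ≡ k
consecutive zero    (x ∷ [])      {p} {post} _ = [] , x , p , post , refl , refl
consecutive zero    (x ∷ y ∷ pre) {p} {post} _ = [] , x , y , pre ++ p ∷ post , refl , refl
consecutive (suc k) (x ∷ pre) (s≤s k<pre) with consecutive k pre k<pre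
... | B , a , b , C , eq , refl = x ∷ B , a , b , C , cong (x ∷_) eq , refl

endpoint : ∀ {n} → Perm n → List (Perm n) → Perm n
endpoint π []      = π
endpoint _ (ρ ∷ w) = endpoint ρ w

module _ {n} {Γ : List (Perm n)} where

  path : ∀ {r π σ} → Reach Γ r π σ → List (Perm n)
  path {zero}      _           = []
  path {suc _} {π} (γ , _ , R) = π · γ ∷ path R

  length-path : ∀ {r π σ} (R : Reach Γ r π σ) → length (path R) ≡ r
  length-path {zero}  _           = refl
  length-path {suc _} (_ , _ , R) = cong suc (length-path R)

  path-chain : ∀ {r π σ} (R : Reach Γ r π σ) → ChainΓ Γ (π ∷ path R)
  path-chain {zero}  _               = tt
  path-chain {suc _} (γ , γ∈Γ , R) = (γ , γ∈Γ , λ _ → refl) , path-chain R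

  endpoint-path : ∀ {r π σ} (R : Reach Γ r π σ) → endpoint π (path R) ≈ σ
  endpoint-path {zero}  π≈σ         = π≈σ
  endpoint-path {suc _} (_ , _ , R) = endpoint-path R

  ChainΓ-tail : ∀ π L → ChainΓ Γ (π ∷ L) → ChainΓ Γ L
  ChainΓ-tail _ []      _            = tt
  ChainΓ-tail _ (_ ∷ _) (_ , chain) = chain

  ChainΓ-step : ∀ A {a b B} → ChainΓ Γ (A ++ a ∷ b ∷ B) → Step Γ a b
  ChainΓ-step []      (step , _) = step
  ChainΓ-step (x ∷ A) chain      = ChainΓ-step A (ChainΓ-tail x (A ++ _) chain)

record Plays {n} (s : Strategy n) (σ : Perm n) (L : List (Perm n)) : Set where
  constructor plays
  field
    next-guess : ∀ pre {p post} → L ≡ pre ++ p ∷ post → s (scores σ pre) ≡ p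

module _ {n} {s : Strategy n} {σ : Perm n} {L : List (Perm n)} (s-plays-L : Plays s σ L) where

  open Plays s-plays-L

  history-plays : ∀ t pre {p post} → L ≡ pre ++ p ∷ post → length pre ≡ t →
                  history s σ t ≡ scores σ pre
  history-plays zero    []        _  _ = refl
  history-plays (suc t) pre {p} {post} L≡ |pre| with initLast pre
  ... | B ∷ʳ′ q = begin
    history s σ t ++ [ score (s (history s σ t)) σ ]
      ≡⟨ cong (λ h → h ++ [ score (s h) σ ]) previous ⟩
    scores σ B ++ [ score (s (scores σ B)) σ ]
      ≡⟨ cong (λ π → scores σ B ++ [ score π σ ]) (next-guess B L≡′) ⟩
    scores σ B ++ [ score q σ ]
      ≡⟨ sym (map-++ _ B [ q ]) ⟩
    scores σ (B ∷ʳ q) ∎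
    where
    open ≡-Reasoning
    L≡′ : L ≡ B ++ q ∷ p ∷ post
    L≡′ = trans L≡ (∷ʳ-++ B q (p ∷ post))
    previous : history s σ t ≡ scores σ B
    previous = history-plays t B L≡′ (suc-injective (trans (sym (length-∷ʳ B q)) |pre|))

  guess-plays : ∀ t pre {p post} → L ≡ pre ++ p ∷ post → length pre ≡ t → guess s σ t ≡ p
  guess-plays t pre L≡ |pre| = trans (cong s (history-plays t pre L≡ |pre|)) (next-guess pre L≡)

  plays-wins : ∀ {pre p post} → L ≡ pre ++ p ∷ post → p ≈ σ → guess s σ (length pre) ≈ σ
  plays-wins {pre} L≡ p≈σ = subst (_≈ σ) (sym (guess-plays _ pre L≡ refl)) p≈σ

  plays-step : ∀ {Γ} → ChainΓ Γ L → ∀ {pre p post} → L ≡ pre ++ p ∷ post →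
               ∀ k → k < length pre → Step Γ (guess s σ k) (guess s σ (suc k))
  plays-step {Γ} chain {pre} L≡ k k<pre with consecutive k pre k<pre
  ... | B , a , b , C , eq , |B| =
    subst₂ (Step Γ) (sym (guess-plays k B L≡a |B|)) (sym (guess-plays (suc k) (B ∷ʳ a) L≡b |Ba|))
           (ChainΓ-step B (subst (ChainΓ Γ) L≡a chain))
    where
    L≡a : L ≡ B ++ a ∷ b ∷ C
    L≡a = trans L≡ eq
    L≡b : L ≡ (B ∷ʳ a) ++ b ∷ C
    L≡b = trans L≡a (sym (∷ʳ-++ B a (b ∷ C)))
    |Ba| : length (B ∷ʳ a) ≡ suc k
    |Ba| = trans (length-∷ʳ B a) (cong suc |B|)

module Expansion {n} (Γ : List (Perm n)) (D : ℕ) (diam : DiamLE Γ D) where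

  route : Perm n → Perm n → List (Perm n)
  route π σ = path (proj₂ (proj₂ (diam π σ)))

  length-route : ∀ π σ → length (route π σ) ≤ D
  length-route π σ with diam π σ
  ... | _ , r≤D , R = subst (_≤ D) (sym (length-path R)) r≤D

  route-chain : ∀ π σ → ChainΓ Γ (π ∷ route π σ)
  route-chain π σ = path-chain (proj₂ (proj₂ (diam π σ)))

  endpoint-route : ∀ π σ → endpoint π (route π σ) ≈ σ
  endpoint-route π σ = endpoint-path (proj₂ (proj₂ (diam π σ)))

  expand : List (Perm n) → List (Perm n) → Perm n → List (Perm n)
  expand ts       (ρ ∷ w) _ = ρ ∷ expand ts w ρ
  expand []       []      _ = []
  expand (t ∷ ts) []      π = expand ts (route π t) π

  expand-chain : ∀ ts w π → ChainΓ Γ (π ∷ w) → ChainΓ Γ (π ∷ expand ts w π)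
  expand-chain ts       (ρ ∷ w) π (step , chain) = step , expand-chain ts w ρ chain
  expand-chain []       []      π _              = tt
  expand-chain (t ∷ ts) []      π _              = expand-chain ts (route π t) π (route-chain π t)

  length-expand : ∀ ts w π → length (expand ts w π) ≤ length w + length ts * D
  length-expand ts       (ρ ∷ w) π = s≤s (length-expand ts w ρ)
  length-expand []       []      π = z≤n
  length-expand (t ∷ ts) []      π =
    ≤-trans (length-expand ts (route π t) π) (+-monoˡ-≤ (length ts * D) (length-route π t))

  -- The score list starts with the score of π itself.
  decode : List (Perm n) → List (Perm n) → Perm n → List ℕ → List ℕ
  decode ts       w       π []       = []
  decode ts       (ρ ∷ w) π (_ ∷ cs) = decode ts w ρ cs
  decode []       []      π (c ∷ _)  = [ c ]
  decode (t ∷ ts) []      π (c ∷ cs) = c ∷ decode ts (route π t) π (c ∷ cs)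

  decode-expand : ∀ σ ts w π {t} → endpoint π w ≈ t →
                  decode ts w π (scores σ (π ∷ expand ts w π)) ≡ scores σ (t ∷ ts)
  decode-expand σ ts        (ρ ∷ w) π {t} end = decode-expand σ ts w ρ {t} end
  decode-expand σ []        []      π {t} end = cong [_] (score-congˡ {π = π} {t} σ end)
  decode-expand σ (t′ ∷ ts) []      π {t} end =
    cong₂ _∷_ (score-congˡ {π = π} {t} σ end)
              (decode-expand σ ts (route π t′) π {t′} (endpoint-route π t′))

  static : 1 ≤ D → ∀ T → StaticLE n T → StaticΓLE Γ (T * D)
  static _   T ([] , _ , correct) = [] , z≤n , tt , correct
  static 1≤D T (π ∷ L , |πL|≤T , final , correct) =
    π ∷ expand L [] π , length-bound , expand-chain L [] π tt ,
    (λ cs → final (decode L [] π cs)) , correct′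
    where
    length-bound : suc (length (expand L [] π)) ≤ T * D
    length-bound = ≤-trans (+-mono-≤ 1≤D (length-expand L [] π)) (*-monoˡ-≤ D |πL|≤T)
    correct′ : ∀ σ → final (decode L [] π (scores σ (π ∷ expand L [] π))) ≈ σ
    correct′ σ = subst (λ cs → final cs ≈ σ) (sym (decode-expand σ L [] π {π} (λ _ → refl)))
                       (correct σ)

  module Simulation (s : Strategy n) where

    -- follow f h w π cs: we are at π, on the route w towards s h, with f more original
    -- guesses to route to; cs are the scores from π onwards.
    follow : ℕ → List ℕ → List (Perm n) → Perm n → List ℕ → Perm n
    follow f       h w       π []       = π
    follow f       h (ρ ∷ w) π (_ ∷ cs) = follow f h w ρ cs
    follow zero    h []      π (_ ∷ _)  = π
    follow (suc f) h []      π (c ∷ cs) =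
      follow f (h ++ [ c ]) (route π (s (h ++ [ c ]))) π (c ∷ cs)

    Γ-strategy : ℕ → Strategy n
    Γ-strategy T = follow T [] [] (s [])

    module _ (σ : Perm n) where

      guessesAfter : ℕ → ℕ → List (Perm n)
      guessesAfter j zero    = []
      guessesAfter j (suc f) = guess s σ (suc j) ∷ guessesAfter (suc j) f

      follow-plays : ∀ f j w π pre {p post} → endpoint π w ≈ guess s σ j →
                     π ∷ expand (guessesAfter j f) w π ≡ pre ++ p ∷ post →
                     follow f (history s σ j) w π (scores σ pre) ≡ p
      follow-plays f       j w       π []        _   eq = ∷-injectiveˡ eq
      follow-plays f       j (ρ ∷ w) π (_ ∷ pre) end eq =
        follow-plays f j w ρ pre end (∷-injectiveʳ eq)
      follow-plays zero    j []      π (_ ∷ pre) {p} {post} _ eq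
        with () ← ++-conicalʳ pre (p ∷ post) (sym (∷-injectiveʳ eq))
      follow-plays (suc f) j []      π (_ ∷ pre) {p} end eq with refl ← ∷-injectiveˡ eq =
        subst (λ h → follow f h (route π (s h)) π (scores σ (π ∷ pre)) ≡ p) (sym next)
              (follow-plays f (suc j) (route π (guess s σ (suc j))) π (π ∷ pre)
                            (endpoint-route π (guess s σ (suc j))) eq)
        where
        next : history s σ j ++ [ score π σ ] ≡ history s σ (suc j)
        next = cong (λ c → history s σ j ++ [ c ]) (score-congˡ {π = π} {guess s σ j} σ end)

      reaches : ∀ i {j f} w π → i ≤ f → endpoint π w ≈ guess s σ j →
                ∃ λ pre → ∃₂ λ p post → π ∷ expand (guessesAfter j f) w π ≡ pre ++ p ∷ post
                  × p ≈ guess s σ (i + j) × length pre ≤ length w + i * D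
      reaches i (ρ ∷ w) π i≤f end with reaches i w ρ i≤f end
      ... | pre , p , post , eq , p≈ , |pre| =
        π ∷ pre , p , post , cong (π ∷_) eq , p≈ , s≤s |pre|
      reaches zero [] π _ end = [] , π , _ , refl , end , z≤n
      reaches (suc i) {f = zero} [] π () _
      reaches (suc i) {j} {suc f} [] π (s≤s i≤f) _
        with reaches i {suc j} {f} (route π (guess s σ (suc j))) π i≤f (endpoint-route π _)
      ... | pre , p , post , eq , p≈ , |pre| =
        pre , p , post , eq , subst (λ k → p ≈ guess s σ k) (+-suc i j) p≈ ,
        ≤-trans |pre| (+-monoˡ-≤ (i * D) (length-route π _))

  adaptive : 1 ≤ D → ∀ T → AdaptiveLE n T → AdaptiveΓLE Γ (T * D)
  adaptive 1≤D T (s , wins) = Γ-strategy T , obeys , wins′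
    where
    open Simulation s

    play : Perm n → List (Perm n)
    play σ = s [] ∷ expand (guessesAfter σ 0 T) [] (s [])

    Γ-strategy-plays : ∀ σ → Plays (Γ-strategy T) σ (play σ)
    Γ-strategy-plays σ = plays (λ pre → follow-plays σ T 0 [] (s []) pre (λ _ → refl))

    hit : ∀ σ → ∃ λ pre → ∃₂ λ p post → play σ ≡ pre ++ p ∷ post × p ≈ σ × length pre < T * D
    hit σ with wins σ
    ... | k , k<T , won with reaches σ k [] (s []) (<⇒≤ k<T) (λ _ → refl)
    ... | pre , p , post , eq , p≈ , |pre| =
      pre , p , post , eq ,
      ≈-trans {π = p} {guess s σ (k + 0)} {σ} p≈
              (subst (λ j → guess s σ j ≈ σ) (sym (+-identityʳ k)) won) ,
      <-≤-trans (≤-trans (s≤s |pre|) (m<n+m (k * D) 1≤D)) (*-monoˡ-≤ D k<T)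

    wins′ : WinsWithin (Γ-strategy T) (T * D)
    wins′ σ with hit σ
    ... | pre , _ , _ , eq , p≈σ , |pre|<TD =
      length pre , |pre|<TD , plays-wins (Γ-strategy-plays σ) eq p≈σ

    obeys : ObeysΓ Γ (Γ-strategy T)
    obeys σ k unwon with hit σ
    ... | pre , _ , _ , eq , p≈σ , _ with k <? length pre
    ... | yes k<pre =
      plays-step (Γ-strategy-plays σ) (expand-chain (guessesAfter σ 0 T) [] (s []) tt) eq k k<pre
    ... | no k≮pre =
      contradiction (plays-wins (Γ-strategy-plays σ) eq p≈σ) (unwon (length pre) (≮⇒≥ k≮pre))

-- For n ≤ 1 the bound D = 0 is admissible, and then the theorem fails.
DiamLE-positive : ∀ {n} {Γ : List (Perm n)} {D} → 2 ≤ n → DiamLE Γ D → 1 ≤ D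
DiamLE-positive (s≤s (s≤s z≤n)) diam with diam id (transpose 0F 1F)
... | zero  , _   , id≈τ with () ← id≈τ 0F
... | suc _ , r≤D , _    = ≤-trans (s≤s z≤n) r≤D

lemma13 : (n : ℕ) → 2 ≤ n → (Γ : List (Perm n)) → Generates Γ →
          (D : ℕ) → DiamLE Γ D →
          ((T : ℕ) → StaticLE n T → StaticΓLE Γ (T * D)) ×
          ((T : ℕ) → AdaptiveLE n T → AdaptiveΓLE Γ (T * D))
lemma13 n 2≤n Γ _ D diam = static 1≤D , adaptive 1≤D
  where
  open Expansion Γ D diam
  1≤D : 1 ≤ D
  1≤D = DiamLE-positive 2≤n diam
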